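{- Let $\varphi(x,\bar y)$ be a formula whose only unary modalities are $\mathtt X^g,\mathtt X^c$, with free variables among $x,\bar y=y_1,\dots,y_l$, such that every occurrence of $x$ lies in the scope of at least $k$ nested unary modalities. Then for every data word $w$ of length $n$, every valuation $S_1,\dots,S_l$ of $y_1,\dots,y_l$, every set $S$ of positions, and every position $i>n-k$: $\varphi$ holds at $i$ in $w$ under the valuation $\bar y:=\bar S$, $x:=S$ iff $\varphi$ holds at $i$ in $w$ under the valuation $\bar y:=\bar S$, $x:=\emptyset$.
   Context: Data words: finite sequences $(a_1,d_1)\cdots(a_n,d_n)$ over $\Sigma\times\mathcal D$ ($\Sigma$ finite, $\mathcal D$ infinite), positions $1,\dots,n$; $i\sim j$ iff $d_i=d_j$; class successor/predecessor of $i$: nearest later/earlier $j\sim i$. $\mu$-calculus: $\varphi::= x\mid A\mid\neg A\mid \mathsf M\varphi\mid\varphi\vee\varphi\mid\varphi\wedge\varphi\mid\mu x.\varphi\mid\nu x.\varphi$, fixpoint variables $x$, atoms $A$: letters and zeroary $\mathsf S,\mathsf P,\mathsf{first}^g,\mathsf{last}^g,\mathsf{first}^c,\mathsf{last}^c$; unary modalities $\mathsf M\in\{\mathtt X^g,\mathtt X^c,\mathtt Y^g,\mathtt Y^c\}$ evaluating the argument at successor, class successor, predecessor, class predecessor (false if nonexistent). Given a valuation of the free variables by sets of positions, a formula denotes a set of positions; $\mathsf{first}^g$/$\mathsf{last}^g$ at first/last position; $\mathsf{first}^c$/$\mathsf{last}^c$ where no class predecessor/successor; $\mathsf S$ at $i$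 iff $i$ not last and $i+1$ is the class successor of $i$; $\mathsf P$ at $i$ iff $i\ne1$ and $i-1$ is the class predecessor of $i$; $\mu,\nu$ least/greatest fixpoints. -}

module Defs where

open import Data.Nat using (ℕ; zero; suc; _<_; _∸_; _≡ᵇ_)
open import Data.Fin using (Fin; toℕ)
open import Data.Fin.Subset using (Subset; _∈_)
open import Data.Bool using (if_then_else_)
open import Data.Product using (Σ; ∃; _×_; _,_)
open import Data.Sum using (_⊎_)
open import Data.Empty using (⊥)
open import Data.Unit using (⊤)
open import Relation.Nullary using (¬_)
open import Relation.Binary.PropositionalEquality using (_≡_; _≢_)

Var : Set
Var = ℕ

data Atom (A : Set) : Set where
  letter : A → Atom A
  S P firstg lastg firstc lastc : Atom A

data Mod : Set where
  Xg Xc Yg Yc : Mod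

data Formula (A : Set) : Set where
  var  : Var → Formula A
  pos  : Atom A → Formula A
  neg  : Atom A → Formula A
  mod  : Mod → Formula A → Formula A
  _∨ᶠ_ : Formula A → Formula A → Formula A
  _∧ᶠ_ : Formula A → Formula A → Formula A
  mu   : Var → Formula A → Formula A
  nu   : Var → Formula A → Formula A

-- Data words; positions are Fin len (position p corresponds to toℕ p + 1).
record DataWord (A D : Set) : Set where
  field
    len : ℕ
    lab : Fin len → A
    dat : Fin len → D

module _ {A D : Set} (w : DataWord A D) where
  open DataWord w

  Pos : Set
  Pos = Fin len

  Succ : Pos → Pos → Set
  Succ i j = toℕ j ≡ suc (toℕ i)

  CSucc : Pos → Pos → Set
  CSucc i j = toℕ i < toℕ j × dat i ≡ dat j
            × (∀ l → toℕ i < toℕ l → toℕ l < toℕ j → dat l ≢ dat i)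

  AtomHolds : Atom A → Pos → Set
  AtomHolds (letter a) i = lab i ≡ a
  AtomHolds S i = ∃ λ j → Succ i j × CSucc i j
  AtomHolds P i = ∃ λ j → Succ j i × CSucc j i
  AtomHolds firstg i = toℕ i ≡ 0
  AtomHolds lastg i = suc (toℕ i) ≡ len
  AtomHolds firstc i = ¬ (∃ λ j → CSucc j i)
  AtomHolds lastc i = ¬ (∃ λ j → CSucc i j)

  Valuation : Set
  Valuation = Var → Subset len

  update : Valuation → Var → Subset len → Valuation
  update ρ x T y = if y ≡ᵇ x then T else ρ y

  ModHolds : Mod → (Pos → Set) → Pos → Set
  ModHolds Xg F i = ∃ λ j → Succ i j × F j
  ModHolds Xc F i = ∃ λ j → CSucc i j × F j
  ModHolds Yg F i = ∃ λ j → Succ j i × F j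
  ModHolds Yc F i = ∃ λ j → CSucc j i × F j

  -- Semantics: φ holds at position i under valuation ρ.
  -- μ is the intersection of all prefixed points, ν the union of all
  -- postfixed points (Knaster–Tarski).
  Sem : Formula A → Valuation → Pos → Set
  Sem (var x) ρ i = i ∈ ρ x
  Sem (pos a) ρ i = AtomHolds a i
  Sem (neg a) ρ i = ¬ AtomHolds a i
  Sem (mod M φ) ρ i = ModHolds M (Sem φ ρ) i
  Sem (φ ∨ᶠ ψ) ρ i = Sem φ ρ i ⊎ Sem ψ ρ i
  Sem (φ ∧ᶠ ψ) ρ i = Sem φ ρ i × Sem ψ ρ i
  Sem (mu x φ) ρ i =
    (T : Subset len) → (∀ j → Sem φ (update ρ x T) j → j ∈ T) → i ∈ T
  Sem (nu x φ) ρ i =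
    Σ (Subset len) λ T → (∀ j → j ∈ T → Sem φ (update ρ x T) j) × i ∈ T

FreeIn : {A : Set} → Var → Formula A → Set
FreeIn z (var y) = z ≡ y
FreeIn z (pos a) = ⊥
FreeIn z (neg a) = ⊥
FreeIn z (mod M φ) = FreeIn z φ
FreeIn z (φ ∨ᶠ ψ) = FreeIn z φ ⊎ FreeIn z ψ
FreeIn z (φ ∧ᶠ ψ) = FreeIn z φ ⊎ FreeIn z ψ
FreeIn z (mu y φ) = z ≢ y × FreeIn z φ
FreeIn z (nu y φ) = z ≢ y × FreeIn z φ

ForwardOnly : {A : Set} → Formula A → Set
ForwardOnly (var y) = ⊤
ForwardOnly (pos a) = ⊤
ForwardOnly (neg a) = ⊤
ForwardOnly (mod Xg φ) = ForwardOnly φ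
ForwardOnly (mod Xc φ) = ForwardOnly φ
ForwardOnly (mod Yg φ) = ⊥
ForwardOnly (mod Yc φ) = ⊥
ForwardOnly (φ ∨ᶠ ψ) = ForwardOnly φ × ForwardOnly ψ
ForwardOnly (φ ∧ᶠ ψ) = ForwardOnly φ × ForwardOnly ψ
ForwardOnly (mu y φ) = ForwardOnly φ
ForwardOnly (nu y φ) = ForwardOnly φ

Guarded : {A : Set} → ℕ → Var → Formula A → Set
Guarded k x (var y) = x ≡ y → k ≡ 0
Guarded k x (pos a) = ⊤
Guarded k x (neg a) = ⊤
Guarded k x (mod M φ) = Guarded (k ∸ 1) x φ
Guarded k x (φ ∨ᶠ ψ) = Guarded k x φ × Guarded k x ψ
Guarded k x (φ ∧ᶠ ψ) = Guarded k x φ × Guarded k x ψ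
Guarded k x (mu y φ) = x ≢ y → Guarded k x φ
Guarded k x (nu y φ) = x ≢ y → Guarded k x φ

module Submission where

-- Formulas without backward modalities look only into the future.
--
-- We prove a monotonicity principle that is stronger than the theorem: if,
-- from position j on, every membership granted by a valuation ρ is also
-- granted by ρ' -- except that for the distinguished variable x only
-- positions at distance at least k from j are required -- then every
-- forward-only formula that is k-guarded in x and holds at j under ρ also
-- holds at j under ρ' ('transfer').  It is proved by induction on the
-- formula: a forward modality moves to a strictly later position and uses up
-- one level of guardedness; for a least fixpoint we enlarge a prefixed point
-- of ρ' by all positions before j, for a greatest fixpoint we cut a
-- postfixed point of ρ down to the positions from j on, so that in both
-- cases the bound variable is only compared from the current position on.
--
-- The theorem follows: at a position i with n < i + k, the valuations
-- x := S and x := ∅ impose no constraint on x (there are no positions at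
-- distance k from i), so 'transfer' applies in both directions.

open import Defs
open import Data.Nat using (ℕ; suc; _+_; _<_)
open import Data.Fin using (Fin; toℕ)
open import Data.Fin.Subset using (Subset; ⊥)
open import Data.List using (List; _∷_)
open import Data.List.Membership.Propositional using (_∈_)
open import Function.Bundles using (_⇔_; _↔_; _↣_)

open import Data.Nat using (_≤_; _∸_; _≡ᵇ_; _≟_; _<?_; _≤?_)
open import Data.Nat.Properties
  using (≤-refl; ≤-trans; ≤-reflexive; <⇒≤; <⇒≱; ≮⇒≥;
         +-suc; +-identityʳ; +-monoʳ-≤; +-monoˡ-≤; m≤n+m∸n; ≡ᵇ⇒≡; ≡⇒≡ᵇ; ≤-pred; module ≤-Reasoning)
open import Data.Fin.Properties using (toℕ<n)
import Data.Fin.Subset as Sub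
open import Data.Fin.Subset.Properties using (_∈?_)
open import Data.Bool using (true; false; T)
open import Data.Bool.Properties using (T-≡)
open import Data.Vec using (tabulate)
open import Data.Vec.Properties using (lookup∘tabulate; []=⇒lookup; lookup⇒[]=)
open import Data.Product using (_,_)
open import Data.Sum using (inj₁; inj₂)
open import Data.Unit using (tt)
open import Data.Empty using (⊥-elim)
open import Relation.Nullary using (yes; no)
open import Relation.Nullary.Decidable using (⌊_⌋; toWitness; fromWitness; _⊎-dec_; _×-dec_)
open import Relation.Unary using (Pred; Decidable)
open import Relation.Binary.PropositionalEquality using (_≡_; _≢_; refl; sym; trans; subst)
open import Function.Bundles using (mk⇔; Equivalence)

-- Moving strictly forward uses up one level of guardedness.
forward-bound : ∀ {m n} k → m < n → m + k ≤ n + (k ∸ 1)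
forward-bound {m} {n} k m<n = begin
  m + k             ≤⟨ +-monoʳ-≤ m (m≤n+m∸n k 1) ⟩
  m + suc (k ∸ 1)   ≡⟨ +-suc m (k ∸ 1) ⟩
  suc m + (k ∸ 1)   ≤⟨ +-monoˡ-≤ (k ∸ 1) m<n ⟩
  n + (k ∸ 1)       ∎
  where open ≤-Reasoning

-- Every formula is 0-guarded in every variable; needed when a binder
-- shadows the distinguished variable and the guardedness hypothesis is lost.
guarded-zero : {A : Set} (x : Var) (φ : Formula A) → Guarded 0 x φ
guarded-zero x (var y) _ = refl
guarded-zero x (pos a) = tt
guarded-zero x (neg a) = tt
guarded-zero x (mod M φ) = guarded-zero x φ
guarded-zero x (φ ∨ᶠ ψ) = guarded-zero x φ , guarded-zero x ψ
guarded-zero x (φ ∧ᶠ ψ) = guarded-zero x φ , guarded-zero x ψ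
guarded-zero x (mu y φ) _ = guarded-zero x φ
guarded-zero x (nu y φ) _ = guarded-zero x φ

⟪_⟫ : ∀ {n p} {P : Pred (Fin n) p} → Decidable P → Subset n
⟪ P? ⟫ = tabulate (λ q → ⌊ P? q ⌋)

∈⟪⟫⁺ : ∀ {n p} {P : Pred (Fin n) p} (P? : Decidable P) {q} → P q → q Sub.∈ ⟪ P? ⟫
∈⟪⟫⁺ P? {q} Pq = lookup⇒[]= q _ (trans (lookup∘tabulate _ q) (Equivalence.to T-≡ (fromWitness {a? = P? q} Pq)))

∈⟪⟫⁻ : ∀ {n p} {P : Pred (Fin n) p} (P? : Decidable P) {q} → q Sub.∈ ⟪ P? ⟫ → P q
∈⟪⟫⁻ P? {q} q∈ =
  toWitness {a? = P? q} (Equivalence.from T-≡ (trans (sym (lookup∘tabulate _ q)) ([]=⇒lookup q∈)))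

_∪before_ : ∀ {n} → Subset n → Fin n → Subset n
T ∪before j = ⟪ (λ q → (q ∈? T) ⊎-dec (toℕ q <? toℕ j)) ⟫

_∩from_ : ∀ {n} → Subset n → Fin n → Subset n
T ∩from j = ⟪ (λ q → (q ∈? T) ×-dec (toℕ j ≤? toℕ q)) ⟫

∪before-from : ∀ {n} {T : Subset n} {j q} → toℕ j ≤ toℕ q → q Sub.∈ T ∪before j → q Sub.∈ T
∪before-from {T = T} {j} j≤q q∈ with ∈⟪⟫⁻ (λ q → (q ∈? T) ⊎-dec (toℕ q <? toℕ j)) q∈
... | inj₁ q∈T = q∈T
... | inj₂ q<j = ⊥-elim (<⇒≱ q<j j≤q)

ContainedFrom : ∀ {n} → Fin n → Subset n → Subset n → Set
ContainedFrom p T₁ T₂ = ∀ q → toℕ p ≤ toℕ q → q Sub.∈ T₁ → q Sub.∈ T₂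

module _ {A D : Set} (w : DataWord A D) where
  open DataWord w using (len)

  Included : ℕ → Var → Valuation w → Valuation w → Pos w → Set
  Included k x ρ ρ' j =
    ∀ z q → toℕ j ≤ toℕ q → (z ≡ x → toℕ j + k ≤ toℕ q) → q Sub.∈ ρ z → q Sub.∈ ρ' z

  included-later : ∀ {k x ρ ρ'} {j p : Pos w} → toℕ j ≤ toℕ p →
                   Included k x ρ ρ' j → Included k x ρ ρ' p
  included-later {k} j≤p inc z q p≤q far =
    inc z q (≤-trans j≤p p≤q) (λ z≡x → ≤-trans (+-monoˡ-≤ k j≤p) (far z≡x))

  included-step : ∀ {k x ρ ρ'} {j j' : Pos w} → toℕ j < toℕ j' →
                  Included k x ρ ρ' j → Included (k ∸ 1) x ρ ρ' j'
  included-step {k} j<j' inc z q j'≤q far =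
    inc z q (≤-trans (<⇒≤ j<j') j'≤q) (λ z≡x → ≤-trans (forward-bound k j<j') (far z≡x))

  update-mono : ∀ {ρ ρ' : Valuation w} y {T₁ T₂} z q →
                (z ≡ y → q Sub.∈ T₁ → q Sub.∈ T₂) → (z ≢ y → q Sub.∈ ρ z → q Sub.∈ ρ' z) →
                q Sub.∈ update w ρ y T₁ z → q Sub.∈ update w ρ' y T₂ z
  update-mono y z q same other with z ≡ᵇ y in eq
  ... | true = same (≡ᵇ⇒≡ z y (subst T (sym eq) tt))
  ... | false = other (λ z≡y → subst T eq (≡⇒≡ᵇ z y z≡y))

  included-bind : ∀ {k x y ρ ρ' T₁ T₂} {p : Pos w} → x ≢ y → ContainedFrom p T₁ T₂ →
                  Included k x ρ ρ' p →
                  Included k x (update w ρ y T₁) (update w ρ' y T₂) p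
  included-bind {y = y} {ρ} {ρ'} _ T⊆ inc z q p≤q far =
    update-mono {ρ} {ρ'} y z q (λ _ → T⊆ q p≤q) (λ _ → inc z q p≤q far)

  included-shadow : ∀ {k x y ρ ρ' T₁ T₂} {p : Pos w} → x ≡ y → ContainedFrom p T₁ T₂ →
                    Included k x ρ ρ' p →
                    Included 0 x (update w ρ y T₁) (update w ρ' y T₂) p
  included-shadow {y = y} {ρ} {ρ'} x≡y T⊆ inc z q p≤q _ =
    update-mono {ρ} {ρ'} y z q (λ _ → T⊆ q p≤q)
      (λ z≢y → inc z q p≤q (λ z≡x → ⊥-elim (z≢y (trans z≡x x≡y))))

  mutual
    transfer : ∀ (φ : Formula A) {k x ρ ρ'} {j : Pos w} → ForwardOnly φ → Guarded k x φ →
               Included k x ρ ρ' j → Sem w φ ρ j → Sem w φ ρ' j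
    transfer (var y) {k} {j = j} _ g inc j∈ = inc y j ≤-refl near j∈
      where
        near : y ≡ _ → toℕ j + k ≤ toℕ j
        near y≡x rewrite g (sym y≡x) = ≤-reflexive (+-identityʳ (toℕ j))
    transfer (pos a) _ _ _ s = s
    transfer (neg a) _ _ _ s = s
    transfer (mod Xg φ) fo g inc (j' , succ , s) =
      j' , succ , transfer φ fo g (included-step (≤-reflexive (sym succ)) inc) s
    transfer (mod Xc φ) fo g inc (j' , csucc@(j<j' , _) , s) =
      j' , csucc , transfer φ fo g (included-step j<j' inc) s
    transfer (φ ∨ᶠ ψ) (foφ , _) (gφ , _) inc (inj₁ s) = inj₁ (transfer φ foφ gφ inc s)
    transfer (φ ∨ᶠ ψ) (_ , foψ) (_ , gψ) inc (inj₂ s) = inj₂ (transfer ψ foψ gψ inc s)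
    transfer (φ ∧ᶠ ψ) (foφ , foψ) (gφ , gψ) inc (sφ , sψ) =
      transfer φ foφ gφ inc sφ , transfer ψ foψ gψ inc sψ
    transfer (mu y φ) {ρ = ρ} {j = j} fo g inc s T' prefixed =
      ∪before-from ≤-refl (s (T' ∪before j) prefixed')
      where
        prefixed' : ∀ p → Sem w φ (update w ρ y (T' ∪before j)) p → p Sub.∈ T' ∪before j
        prefixed' p sp with toℕ p <? toℕ j
        ... | yes p<j = ∈⟪⟫⁺ _ (inj₂ p<j)
        ... | no p≮j = ∈⟪⟫⁺ _ (inj₁ (prefixed p
                (transfer-body φ y fo g (included-later j≤p inc)
                   (λ q p≤q → ∪before-from (≤-trans j≤p p≤q)) sp)))
          where j≤p = ≮⇒≥ p≮j
    transfer (nu y φ) {ρ' = ρ'} {j = j} fo g inc (T' , postfixed , j∈T') =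
      T' ∩from j , postfixed' , ∈⟪⟫⁺ _ (j∈T' , ≤-refl)
      where
        postfixed' : ∀ p → p Sub.∈ T' ∩from j → Sem w φ (update w ρ' y (T' ∩from j)) p
        postfixed' p p∈ with ∈⟪⟫⁻ (λ q → (q ∈? T') ×-dec (toℕ j ≤? toℕ q)) p∈
        ... | p∈T' , j≤p =
          transfer-body φ y fo g (included-later j≤p inc)
            (λ q p≤q q∈T' → ∈⟪⟫⁺ _ (q∈T' , ≤-trans j≤p p≤q)) (postfixed p p∈T')

    transfer-body : ∀ (φ : Formula A) y {k x ρ ρ' T₁ T₂} {p : Pos w} → ForwardOnly φ →
                    (x ≢ y → Guarded k x φ) → Included k x ρ ρ' p → ContainedFrom p T₁ T₂ →
                    Sem w φ (update w ρ y T₁) p → Sem w φ (update w ρ' y T₂) p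
    transfer-body φ y {x = x} fo g inc T⊆ with x ≟ y
    ... | yes x≡y = transfer φ fo (guarded-zero x φ) (included-shadow x≡y T⊆ inc)
    ... | no x≢y = transfer φ fo (g x≢y) (included-bind x≢y T⊆ inc)

  -- Near the end of the word, any two values of x are included in each other:
  -- no position lies at distance k from i.
  included-at-end : ∀ k x ρ (T₁ T₂ : Subset len) (i : Pos w) → len < suc (toℕ i) + k →
                    Included k x (update w ρ x T₁) (update w ρ x T₂) i
  included-at-end k x ρ T₁ T₂ i end z q _ far =
    update-mono {ρ} {ρ} x z q
      (λ z≡x → ⊥-elim (<⇒≱ (toℕ<n q) (≤-trans (≤-pred end) (far z≡x))))
      (λ _ q∈ → q∈)

lemma4 : {A D : Set} (m : ℕ) → A ↔ Fin m → ℕ ↣ D →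
    (φ : Formula A) (x : Var) (ys : List Var) (k : ℕ) →
    ForwardOnly φ →
    (∀ z → FreeIn z φ → z ∈ x ∷ ys) →
    Guarded k x φ →
    (w : DataWord A D) (ρ : Valuation w) (T : Subset (DataWord.len w))
    (i : Fin (DataWord.len w)) →
    DataWord.len w < suc (toℕ i) + k →
    Sem w φ (update w ρ x T) i ⇔ Sem w φ (update w ρ x ⊥) i
lemma4 _ _ _ φ x _ k fo _ g w ρ T i end =
  mk⇔ (transfer w φ fo g (included-at-end w k x ρ T ⊥ i end))
      (transfer w φ fo g (included-at-end w k x ρ ⊥ T i end))
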